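{- Fix integers $L\ge1$, $r\ge1$, $N$, and $\beta\in(0,1)$, and let $m=N-L(r-1)-r$ with $m\ge 0$. Then $$\pi_r(N,L)=\beta^r\sum_{s=0}^{m}\binom{s+r-1}{r-1}(1-\beta)^{\max\{m-L,\,s\}}.$$
   Context: For integers $r,M$ define $P(r,M)=\binom{M-Lr}{r}\beta^r(1-\beta)^{M-Lr-r}$ if $r\ge 0$ and $M\ge (L+1)r$, and $P(r,M)=0$ otherwise. For integers $N\ge 0$ and $r$ define $$\pi_r(N,L)=P(r,N)+\beta\sum_{i=1}^{L}P(r-1,N-i).$$
   Formalization: The parameter β ranges over the rationals in $(0,1)$, so $\pi_r(N,L)$ and $P(r,M)$ are computed in ℚ. -}

module Defs where

open import Data.Nat as ℕ using (ℕ; zero; suc)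
open import Data.Nat.Combinatorics using (_C_)
open import Data.Integer as ℤ using (ℤ; +_; -[1+_]; ∣_∣)
open import Data.Integer.Properties as ℤP using ()
open import Data.Rational using (ℚ; 0ℚ; 1ℚ; _+_; _*_; _-_; _/_)
open import Relation.Nullary using (yes; no)

infixr 8 _^ℚ_
_^ℚ_ : ℚ → ℕ → ℚ
x ^ℚ zero  = 1ℚ
x ^ℚ suc n = x * (x ^ℚ n)

ℕ→ℚ : ℕ → ℚ
ℕ→ℚ n = (+ n) / 1

Σ₁ : ℕ → (ℕ → ℚ) → ℚ
Σ₁ zero    f = 0ℚ
Σ₁ (suc n) f = Σ₁ n f + f (suc n)

Σ₀ : ℕ → (ℕ → ℚ) → ℚ
Σ₀ zero    f = f 0
Σ₀ (suc m) f = Σ₀ m f + f (suc m)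

P : (L : ℕ) (β : ℚ) → ℤ → ℤ → ℚ
P L β -[1+ _ ] M = 0ℚ
P L β (+ r) M with (+ (suc L ℕ.* r)) ℤ.≤? M
... | yes _ = ℕ→ℚ (∣ M ℤ.- + (L ℕ.* r) ∣ C r) * (β ^ℚ r)
              * ((1ℚ - β) ^ℚ ∣ M ℤ.- + (L ℕ.* r) ℤ.- + r ∣)
... | no  _ = 0ℚ

π : (r : ℤ) (N L : ℕ) (β : ℚ) → ℚ
π r N L β = P L β r (+ N) + β * Σ₁ L (λ i → P L β (r ℤ.- + 1) (+ N ℤ.- + i))

{-# OPTIONS --safe #-}
-- Write r = R + 1 and m = N − L R − r.  As a function of M, P(s, M) vanishes for M < (L+1)s and
-- equals β^s C(k+s, s) (1−β)^k at M = (L+1)s + k.  Hence P(r, N) = β^r C(m−L+r, r) (1−β)^(m−L)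
-- (zero if m < L), and β P(R, N−i) = β^r C(s+R, R) (1−β)^s with s = m+1−i (zero if s < 0).
-- On the right-hand side the terms with s ≤ m−L all carry (1−β)^(m−L), and by the hockey-stick
-- identity their coefficients add up to C(m−L+r, r); the remaining terms m−L < s ≤ m are exactly
-- the β P(R, N−i) for 1 ≤ i ≤ min(L, m+1).
module Submission where

open import Defs
open import Data.Nat using (ℕ; _≤_; _+_; _*_; _∸_; _⊔_)
open import Data.Nat.Combinatorics using (_C_)
open import Data.Integer using (+_)
open import Data.Rational using (ℚ; 0ℚ; 1ℚ; _<_; _-_) renaming (_*_ to _*ℚ_)
open import Relation.Binary.PropositionalEquality using (_≡_)

open import Data.Nat using (zero; suc; z≤n)
import Data.Nat.Properties as ℕ
open import Data.Nat.Combinatorics using (nCn≡1; nCk+nC[k+1]≡[n+1]C[k+1])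
import Data.Nat.Tactic.RingSolver as ℕ-Ring
import Data.Nat.Coprimality as Coprimality
open import Data.Integer as ℤ using (ℤ; -[1+_]; _⊖_)
import Data.Integer.Properties as ℤ
import Data.Integer.Tactic.RingSolver as ℤ-Ring
open import Data.Rational using (mkℚ) renaming (_+_ to _+ℚ_)
import Data.Rational.Properties as ℚ
open import Data.Rational.Solver using (module +-*-Solver)
open import Function using (_∘_)
open import Relation.Binary.PropositionalEquality
  using (refl; sym; trans; cong; cong₂; subst; module ≡-Reasoning)
open import Relation.Nullary using (¬_; yes; no; contradiction)

Σ₀-cong : ∀ m {f g : ℕ → ℚ} → (∀ s → s ≤ m → f s ≡ g s) → Σ₀ m f ≡ Σ₀ m g
Σ₀-cong zero    f≡g = f≡g 0 z≤n
Σ₀-cong (suc m) f≡g =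
  cong₂ _+ℚ_ (Σ₀-cong m (λ s s≤m → f≡g s (ℕ.m≤n⇒m≤1+n s≤m))) (f≡g (suc m) ℕ.≤-refl)

Σ₀-*ʳ : ∀ m (f : ℕ → ℚ) c → Σ₀ m (λ s → f s *ℚ c) ≡ Σ₀ m f *ℚ c
Σ₀-*ʳ zero    f c = refl
Σ₀-*ʳ (suc m) f c = trans (cong (_+ℚ f (suc m) *ℚ c) (Σ₀-*ʳ m f c))
                          (sym (ℚ.*-distribʳ-+ c (Σ₀ m f) (f (suc m))))

Σ₁-cong : ∀ n {f g : ℕ → ℚ} → (∀ i → f (suc i) ≡ g (suc i)) → Σ₁ n f ≡ Σ₁ n g
Σ₁-cong zero    f≡g = refl
Σ₁-cong (suc n) f≡g = cong₂ _+ℚ_ (Σ₁-cong n f≡g) (f≡g n)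

Σ₁-*ˡ : ∀ n c (f : ℕ → ℚ) → Σ₁ n (λ i → c *ℚ f i) ≡ c *ℚ Σ₁ n f
Σ₁-*ˡ zero    c f = sym (ℚ.*-zeroʳ c)
Σ₁-*ˡ (suc n) c f = trans (cong (_+ℚ c *ℚ f (suc n)) (Σ₁-*ˡ n c f))
                          (sym (ℚ.*-distribˡ-+ c (Σ₁ n f) (f (suc n))))

Σ₁-zero : ∀ n → Σ₁ n (λ _ → 0ℚ) ≡ 0ℚ
Σ₁-zero zero    = refl
Σ₁-zero (suc n) = trans (ℚ.+-identityʳ _) (Σ₁-zero n)

Σ₁-sucˡ : ∀ n (f : ℕ → ℚ) → Σ₁ (suc n) f ≡ f 1 +ℚ Σ₁ n (f ∘ suc)
Σ₁-sucˡ zero    f = trans (ℚ.+-identityˡ (f 1)) (sym (ℚ.+-identityʳ (f 1)))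
Σ₁-sucˡ (suc n) f = trans (cong (_+ℚ f (suc (suc n))) (Σ₁-sucˡ n f))
                          (ℚ.+-assoc (f 1) (Σ₁ n (f ∘ suc)) (f (suc (suc n))))

extendByZero : (ℕ → ℚ) → ℤ → ℚ
extendByZero f (+ n)    = f n
extendByZero f -[1+ n ] = 0ℚ

extendByZero-cong : ∀ {f g : ℕ → ℚ} → (∀ n → f n ≡ g n) →
                    ∀ i → extendByZero f i ≡ extendByZero g i
extendByZero-cong f≡g (+ n)    = f≡g n
extendByZero-cong f≡g -[1+ n ] = refl

module _ (a : ℕ → ℚ) (x : ℚ) where

  weighted : ℕ → ℚ
  weighted k = a k *ℚ x ^ℚ k

  cumulative : ℕ → ℚ
  cumulative k = Σ₀ k a *ℚ x ^ℚ k

  shifted : ℕ → ℕ → ℚ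
  shifted k i = extendByZero weighted (k ⊖ i)

  shifted-suc : ∀ k i → shifted (suc k) (suc i) ≡ shifted k i
  shifted-suc k i = cong (extendByZero weighted) (ℤ.[1+m]⊖[1+n]≡m⊖n k i)

  Σ₀-⊔-exponent : ∀ m L →
    Σ₀ m (λ s → a s *ℚ x ^ℚ ((m ∸ L) ⊔ s))
      ≡ extendByZero cumulative (m ⊖ L) +ℚ Σ₁ L (shifted (suc m))
  Σ₀-⊔-exponent m zero = begin
    Σ₀ m (λ s → a s *ℚ x ^ℚ (m ⊔ s))
      ≡⟨ Σ₀-cong m (λ s s≤m → cong (λ e → a s *ℚ x ^ℚ e) (ℕ.m≥n⇒m⊔n≡m s≤m)) ⟩
    Σ₀ m (λ s → a s *ℚ x ^ℚ m)
      ≡⟨ Σ₀-*ʳ m a (x ^ℚ m) ⟩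
    cumulative m
      ≡⟨ ℚ.+-identityʳ (cumulative m) ⟨
    cumulative m +ℚ 0ℚ ∎
    where open ≡-Reasoning
  Σ₀-⊔-exponent zero (suc L) = begin
    weighted 0
      ≡⟨ ℚ.+-identityʳ (weighted 0) ⟨
    weighted 0 +ℚ 0ℚ
      ≡⟨ cong (weighted 0 +ℚ_) (trans (Σ₁-cong L (λ _ → refl)) (Σ₁-zero L)) ⟨
    weighted 0 +ℚ Σ₁ L (shifted 1 ∘ suc)
      ≡⟨ Σ₁-sucˡ L (shifted 1) ⟨
    Σ₁ (suc L) (shifted 1)
      ≡⟨ ℚ.+-identityˡ (Σ₁ (suc L) (shifted 1)) ⟨
    0ℚ +ℚ Σ₁ (suc L) (shifted 1) ∎
    where open ≡-Reasoning
  Σ₀-⊔-exponent (suc m) (suc L) = begin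
    Σ₀ m (λ s → a s *ℚ x ^ℚ ((m ∸ L) ⊔ s)) +ℚ a (suc m) *ℚ x ^ℚ ((m ∸ L) ⊔ suc m)
      ≡⟨ cong₂ _+ℚ_ (Σ₀-⊔-exponent m L)
                    (cong (λ e → a (suc m) *ℚ x ^ℚ e) (ℕ.m≤n⇒m⊔n≡n m∸L≤1+m)) ⟩
    (collapsed +ℚ Σ₁ L (shifted (suc m))) +ℚ weighted (suc m)
      ≡⟨ ℚ.+-assoc collapsed (Σ₁ L (shifted (suc m))) (weighted (suc m)) ⟩
    collapsed +ℚ (Σ₁ L (shifted (suc m)) +ℚ weighted (suc m))
      ≡⟨ cong (collapsed +ℚ_) (ℚ.+-comm (Σ₁ L (shifted (suc m))) (weighted (suc m))) ⟩
    collapsed +ℚ (weighted (suc m) +ℚ Σ₁ L (shifted (suc m)))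
      ≡⟨ cong₂ (λ c t → c +ℚ (weighted (suc m) +ℚ t))
               (cong (extendByZero cumulative) (ℤ.[1+m]⊖[1+n]≡m⊖n m L))
               (Σ₁-cong L (λ i → shifted-suc (suc m) (suc i))) ⟨
    collapsed′ +ℚ (weighted (suc m) +ℚ Σ₁ L (shifted (suc (suc m)) ∘ suc))
      ≡⟨ cong (collapsed′ +ℚ_) (Σ₁-sucˡ L (shifted (suc (suc m)))) ⟨
    collapsed′ +ℚ Σ₁ (suc L) (shifted (suc (suc m))) ∎
    where
    open ≡-Reasoning
    collapsed collapsed′ : ℚ
    collapsed  = extendByZero cumulative (m ⊖ L)
    collapsed′ = extendByZero cumulative (suc m ⊖ suc L)
    m∸L≤1+m : m ∸ L ≤ suc m
    m∸L≤1+m = ℕ.≤-trans (ℕ.m∸n≤m m L) (ℕ.n≤1+n m)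

ℕ→ℚ≡mkℚ : ∀ n → ℕ→ℚ n ≡ mkℚ (+ n) 0 (Coprimality.sym (Coprimality.1-coprimeTo n))
ℕ→ℚ≡mkℚ n = ℚ.normalize-coprime (Coprimality.sym (Coprimality.1-coprimeTo n))

ℕ→ℚ-homo-+ : ∀ p q → ℕ→ℚ (p + q) ≡ ℕ→ℚ p +ℚ ℕ→ℚ q
ℕ→ℚ-homo-+ p q
  rewrite ℕ→ℚ≡mkℚ p | ℕ→ℚ≡mkℚ q | ℤ.*-identityʳ (+ p) | ℤ.*-identityʳ (+ q) = refl

hockey-stick : ∀ R t → Σ₀ t (λ s → ℕ→ℚ ((s + R) C R)) ≡ ℕ→ℚ (suc (t + R) C suc R)
hockey-stick R zero    = cong ℕ→ℚ (trans (nCn≡1 R) (sym (nCn≡1 (suc R))))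
hockey-stick R (suc t) = begin
  Σ₀ t (λ s → ℕ→ℚ ((s + R) C R)) +ℚ ℕ→ℚ (suc (t + R) C R)
    ≡⟨ cong (_+ℚ ℕ→ℚ (suc (t + R) C R)) (hockey-stick R t) ⟩
  ℕ→ℚ (suc (t + R) C suc R) +ℚ ℕ→ℚ (suc (t + R) C R)
    ≡⟨ ℚ.+-comm (ℕ→ℚ (suc (t + R) C suc R)) (ℕ→ℚ (suc (t + R) C R)) ⟩
  ℕ→ℚ (suc (t + R) C R) +ℚ ℕ→ℚ (suc (t + R) C suc R)
    ≡⟨ ℕ→ℚ-homo-+ (suc (t + R) C R) (suc (t + R) C suc R) ⟨
  ℕ→ℚ (suc (t + R) C R + suc (t + R) C suc R)
    ≡⟨ cong ℕ→ℚ (nCk+nC[k+1]≡[n+1]C[k+1] (suc (t + R)) R) ⟩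
  ℕ→ℚ (suc (suc t + R) C suc R) ∎
  where open ≡-Reasoning

+[m+k]-+[n+k]≡m⊖n : ∀ m n k → + (m + k) ℤ.- + (n + k) ≡ m ⊖ n
+[m+k]-+[n+k]≡m⊖n m n k = begin
  + (m + k) ℤ.- + (n + k)             ≡⟨ cong₂ ℤ._-_ (ℤ.pos-+ m k) (ℤ.pos-+ n k) ⟩
  (+ m ℤ.+ + k) ℤ.- (+ n ℤ.+ + k)     ≡⟨ cancel (+ m) (+ n) (+ k) ⟩
  + m ℤ.- + n                         ≡⟨ ℤ.m-n≡m⊖n m n ⟩
  m ⊖ n                               ∎
  where
  open ≡-Reasoning
  cancel : ∀ i j l → (i ℤ.+ l) ℤ.- (j ℤ.+ l) ≡ i ℤ.- j
  cancel = ℤ-Ring.solve-∀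

+[m+k]-+n-+k≡m⊖n : ∀ m n k → + (m + k) ℤ.- + n ℤ.- + k ≡ m ⊖ n
+[m+k]-+n-+k≡m⊖n m n k = begin
  + (m + k) ℤ.- + n ℤ.- + k           ≡⟨ cong (λ i → i ℤ.- + n ℤ.- + k) (ℤ.pos-+ m k) ⟩
  (+ m ℤ.+ + k) ℤ.- + n ℤ.- + k       ≡⟨ cancel (+ m) (+ n) (+ k) ⟩
  + m ℤ.- + n                         ≡⟨ ℤ.m-n≡m⊖n m n ⟩
  m ⊖ n                               ∎
  where
  open ≡-Reasoning
  cancel : ∀ i j l → (i ℤ.+ l) ℤ.- j ℤ.- l ≡ i ℤ.- j
  cancel = ℤ-Ring.solve-∀

binomialWeight : ℚ → ℕ → ℕ → ℚ
binomialWeight β r k = ℕ→ℚ ((k + r) C r) *ℚ (1ℚ - β) ^ℚ k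

P-onSupport : ∀ L β r k → P L β (+ r) (+ (k + suc L * r)) ≡ β ^ℚ r *ℚ binomialWeight β r k
P-onSupport L β r k with + (suc L * r) ℤ.≤? + (k + suc L * r)
... | no  c≰M = contradiction (ℤ.+≤+ (ℕ.m≤n+m (suc L * r) k)) c≰M
... | yes _ = begin
  ℕ→ℚ (ℤ.∣ X ∣ C r) *ℚ β ^ℚ r *ℚ (1ℚ - β) ^ℚ ℤ.∣ X ℤ.- + r ∣
    ≡⟨ cong (λ n → ℕ→ℚ (ℤ.∣ n ∣ C r) *ℚ β ^ℚ r *ℚ (1ℚ - β) ^ℚ ℤ.∣ n ℤ.- + r ∣) X≡k+r ⟩
  ℕ→ℚ ((k + r) C r) *ℚ β ^ℚ r *ℚ (1ℚ - β) ^ℚ ℤ.∣ + (k + r) ℤ.- + r ∣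
    ≡⟨ cong (λ n → ℕ→ℚ ((k + r) C r) *ℚ β ^ℚ r *ℚ (1ℚ - β) ^ℚ ℤ.∣ n ∣)
            (+[m+k]-+[n+k]≡m⊖n k 0 r) ⟩
  ℕ→ℚ ((k + r) C r) *ℚ β ^ℚ r *ℚ (1ℚ - β) ^ℚ k
    ≡⟨ solve 3 (λ c b y → c :* b :* y := b :* (c :* y))
             refl (ℕ→ℚ ((k + r) C r)) (β ^ℚ r) ((1ℚ - β) ^ℚ k) ⟩
  β ^ℚ r *ℚ binomialWeight β r k ∎
  where
  open ≡-Reasoning
  open +-*-Solver
  X : ℤ
  X = + (k + suc L * r) ℤ.- + (L * r)
  X≡k+r : X ≡ + (k + r)
  X≡k+r = trans (cong (λ n → + n ℤ.- + (L * r)) (sym (ℕ.+-assoc k r (L * r))))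
                (+[m+k]-+[n+k]≡m⊖n (k + r) 0 (L * r))

P-offSupport : ∀ L β r M → ¬ (+ (suc L * r) ℤ.≤ M) → P L β (+ r) M ≡ 0ℚ
P-offSupport L β r M c≰M with + (suc L * r) ℤ.≤? M
... | yes c≤M = contradiction c≤M c≰M
... | no  _   = refl

P≡extendByZero : ∀ L β r M →
  P L β (+ r) M ≡ β ^ℚ r *ℚ extendByZero (binomialWeight β r) (M ℤ.- + (suc L * r))
P≡extendByZero L β r M with M ℤ.- + (suc L * r) in eq
... | + k      = trans (cong (P L β (+ r)) M≡k+c) (P-onSupport L β r k)
  where
  M≡k+c : M ≡ + (k + suc L * r)
  M≡k+c = begin
    M                                    ≡⟨ i≡i-j+j M (+ (suc L * r)) ⟩
    (M ℤ.- + (suc L * r)) ℤ.+ + (suc L * r) ≡⟨ cong (ℤ._+ + (suc L * r)) eq ⟩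
    + k ℤ.+ + (suc L * r)                ≡⟨ ℤ.pos-+ k (suc L * r) ⟨
    + (k + suc L * r)                    ∎
    where
    open ≡-Reasoning
    i≡i-j+j : ∀ i j → i ≡ i ℤ.- j ℤ.+ j
    i≡i-j+j = ℤ-Ring.solve-∀
... | -[1+ j ] = trans (P-offSupport L β r M c≰M) (sym (ℚ.*-zeroʳ (β ^ℚ r)))
  where
  c≰M : ¬ (+ (suc L * r) ℤ.≤ M)
  c≰M c≤M with subst (ℤ.0ℤ ℤ.≤_) eq (ℤ.i≤j⇒0≤j-i c≤M)
  ... | ()

π-closedForm : ∀ L R m β →
  π (+ suc R) (m + (L * R + suc R)) L β
    ≡ β ^ℚ suc R *ℚ Σ₀ m (λ s → ℕ→ℚ ((s + R) C R) *ℚ (1ℚ - β) ^ℚ ((m ∸ L) ⊔ s))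
π-closedForm L R m β = begin
  P L β (+ suc R) (+ N) +ℚ β *ℚ Σ₁ L (λ i → P L β (+ R) (+ N ℤ.- + i))
    ≡⟨ cong₂ (λ u v → u +ℚ β *ℚ v) outer-term (Σ₁-cong L (λ i → inner-term (suc i))) ⟩
  β ^ℚ suc R *ℚ E +ℚ β *ℚ Σ₁ L (λ i → β ^ℚ R *ℚ shifted a x (suc m) i)
    ≡⟨ cong (λ v → β ^ℚ suc R *ℚ E +ℚ β *ℚ v) (Σ₁-*ˡ L (β ^ℚ R) (shifted a x (suc m))) ⟩
  β ^ℚ suc R *ℚ E +ℚ β *ℚ (β ^ℚ R *ℚ S)
    ≡⟨ solve 4 (λ b c e t → (b :* c) :* e :+ b :* (c :* t) := (b :* c) :* (e :+ t))
             refl β (β ^ℚ R) E S ⟩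
  β ^ℚ suc R *ℚ (E +ℚ S)
    ≡⟨ cong (β ^ℚ suc R *ℚ_) (Σ₀-⊔-exponent a x m L) ⟨
  β ^ℚ suc R *ℚ Σ₀ m (λ s → a s *ℚ x ^ℚ ((m ∸ L) ⊔ s)) ∎
  where
  open ≡-Reasoning
  open +-*-Solver
  N = m + (L * R + suc R)
  x = 1ℚ - β
  a : ℕ → ℚ
  a s = ℕ→ℚ ((s + R) C R)
  E = extendByZero (cumulative a x) (m ⊖ L)
  S = Σ₁ L (shifted a x (suc m))

  outer-index : + N ℤ.- + (suc L * suc R) ≡ m ⊖ L
  outer-index = trans (cong (λ n → + N ℤ.- + n) (expand L R))
                      (+[m+k]-+[n+k]≡m⊖n m L (L * R + suc R))
    where
    expand : ∀ l q → suc l * suc q ≡ l + (l * q + suc q)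
    expand = ℕ-Ring.solve-∀

  inner-index : ∀ i → + N ℤ.- + i ℤ.- + (suc L * R) ≡ suc m ⊖ i
  inner-index i = trans (cong (λ n → + n ℤ.- + i ℤ.- + (suc L * R)) (regroup m L R))
                        (+[m+k]-+n-+k≡m⊖n (suc m) i (suc L * R))
    where
    regroup : ∀ k l q → k + (l * q + suc q) ≡ suc k + suc l * q
    regroup = ℕ-Ring.solve-∀

  binomial≡cumulative : ∀ k → binomialWeight β (suc R) k ≡ cumulative a x k
  binomial≡cumulative k = cong (_*ℚ x ^ℚ k)
    (trans (cong (λ n → ℕ→ℚ (n C suc R)) (ℕ.+-suc k R)) (sym (hockey-stick R k)))

  outer-term : P L β (+ suc R) (+ N) ≡ β ^ℚ suc R *ℚ E
  outer-term = begin
    P L β (+ suc R) (+ N)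
      ≡⟨ P≡extendByZero L β (suc R) (+ N) ⟩
    β ^ℚ suc R *ℚ extendByZero (binomialWeight β (suc R)) (+ N ℤ.- + (suc L * suc R))
      ≡⟨ cong (λ j → β ^ℚ suc R *ℚ extendByZero (binomialWeight β (suc R)) j) outer-index ⟩
    β ^ℚ suc R *ℚ extendByZero (binomialWeight β (suc R)) (m ⊖ L)
      ≡⟨ cong (β ^ℚ suc R *ℚ_) (extendByZero-cong binomial≡cumulative (m ⊖ L)) ⟩
    β ^ℚ suc R *ℚ E ∎

  inner-term : ∀ i → P L β (+ R) (+ N ℤ.- + i) ≡ β ^ℚ R *ℚ shifted a x (suc m) i
  inner-term i = trans (P≡extendByZero L β R (+ N ℤ.- + i))
                       (cong (λ j → β ^ℚ R *ℚ extendByZero (weighted a x) j) (inner-index i))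

corollary3p3 : (L r N : ℕ) (β : ℚ) → 1 ≤ L → 1 ≤ r → 0ℚ < β → β < 1ℚ →
    (L * (r ∸ 1) + r ≤ N) →
    let m = N ∸ (L * (r ∸ 1) + r) in
    π (+ r) N L β ≡ (β ^ℚ r) *ℚ Σ₀ m (λ s → ℕ→ℚ ((s + (r ∸ 1)) C (r ∸ 1)) *ℚ ((1ℚ - β) ^ℚ ((m ∸ L) ⊔ s)))
corollary3p3 L (suc R) N β _ _ _ _ N≥c =
  subst (λ n → π (+ suc R) n L β ≡ rhs) (ℕ.m∸n+n≡m N≥c) (π-closedForm L R m β)
  where
  m = N ∸ (L * R + suc R)
  rhs = β ^ℚ suc R *ℚ Σ₀ m (λ s → ℕ→ℚ ((s + R) C R) *ℚ (1ℚ - β) ^ℚ ((m ∸ L) ⊔ s))
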